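{- For every integer $l>3$ and every $n$, the number of graphs on vertex set $\{1,\dots,n\}$ with no induced cycle of length $2l$ is at least $2^{(1-\frac{1}{l-1})\binom{n}{2}}\,B_{\lceil n/(l-1)\rceil}$, where $B_m$ denotes the $m$th Bell number.
   Context: $B_m$ is the number of set partitions of an $m$-element set. -}

module Defs where

open import Data.Nat using (ℕ; zero; suc; _+_; _*_; _∸_; _/_)
open import Data.Nat.Combinatorics using (_C_)
open import Data.Bool using (Bool; true; false)
open import Data.Fin using (Fin; toℕ)
open import Data.Vec using (Vec; []; _∷_; _∷ʳ_; lookup; tabulate; zipWith; sum; last)
open import Data.Product using (Σ; _×_)
open import Data.Sum using (_⊎_)
open import Function.Definitions using (Injective)
open import Function.Bundles using (_⇔_)
open import Relation.Binary.PropositionalEquality using (_≡_)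

AdjMatrix : ℕ → Set
AdjMatrix n = Vec (Vec Bool n) n

Adj : ∀ {n} → AdjMatrix n → Fin n → Fin n → Set
Adj M a b = lookup (lookup M a) b ≡ true

IsSimpleGraph : ∀ {n} → AdjMatrix n → Set
IsSimpleGraph {n} M =
  ((a b : Fin n) → lookup (lookup M a) b ≡ lookup (lookup M b) a)
  × ((a : Fin n) → lookup (lookup M a) a ≡ false)

CycAdj : (k : ℕ) → Fin k → Fin k → Set
CycAdj k i j =
  (suc (toℕ i) ≡ toℕ j) ⊎ (suc (toℕ j) ≡ toℕ i)
  ⊎ ((toℕ i ≡ 0 × suc (toℕ j) ≡ k) ⊎ (toℕ j ≡ 0 × suc (toℕ i) ≡ k))

HasInducedCycle : ∀ {n} → AdjMatrix n → ℕ → Set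
HasInducedCycle {n} M k =
  Σ (Fin k → Fin n) λ v →
    Injective _≡_ _≡_ v × ((i j : Fin k) → Adj M (v i) (v j) ⇔ CycAdj k i j)

ceilDiv : ℕ → ℕ → ℕ
ceilDiv n zero = 0
ceilDiv n (suc d) = (n + d) / suc d

-- Bell numbers via B_0 = 1, B_{m+1} = Σ_{k=0}^{m} C(m,k) B_k.
-- bellVec m = (B_0, …, B_m).
bellVec : (m : ℕ) → Vec ℕ (suc m)
bellVec zero = 1 ∷ []
bellVec (suc m) =
  bellVec m ∷ʳ sum (zipWith _*_ (tabulate (λ k → m C toℕ k)) (bellVec m))

Bell : ℕ → ℕ
Bell m = last (bellVec m)

-- Split the vertices into d = l - 1 classes by their residue modulo d. Make classes 1, …, d - 1
-- cliques, let class 0, which has ⌈n/d⌉ vertices, induce the complement of a star forest whose stars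
-- are the blocks of a set partition (centred at their least elements), and choose the edges between
-- distinct classes freely; these are at least (1 - 1/d) C(n,2) pairs. Distinct choices give distinct
-- graphs, so there are at least B_⌈n/d⌉ 2^((1 - 1/d) C(n,2)) of them. None contains an induced C_{2d+2}:
-- its d + 1 even and d + 1 odd positions each contain two vertices of one class, which are non-adjacent
-- on the cycle and hence in the graph, so they lie in class 0 and are joined in the star forest. A star
-- edge between the two pairs would give a path with three edges in the star forest; otherwise the two
-- even vertices would have the two odd ones as common neighbours on a cycle of length at least 6.
module Submission where

open import Defs
open import Data.Nat using (ℕ; zero; suc; _<_; _≤_; _+_; _*_; _∸_; _^_; _⊔_; _⊓_; z≤n; s≤s; parity)
open import Data.Nat.Properties
open import Data.Nat.DivMod using (_%_; _/_; _mod_; m≡m%n+[m/n]*n; m*n%n≡0; m*n/n≡m; m/n*n≤m)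
open import Data.Nat.Combinatorics using (_C_; nCk+nC[k+1]≡[n+1]C[k+1]; k>n⇒nCk≡0; nC1≡n)
open import Data.Nat.ListAction using (sum)
open import Data.Nat.ListAction.Properties using (sum-++)
open import Data.Parity using (0ℙ; 1ℙ; _⁻¹)
open import Data.Parity.Properties using (suc-homo-⁻¹; ⁻¹-selfInverse; p≢p⁻¹; *-homo-*)
open import Data.Bool using (Bool; true; false; if_then_else_; not)
open import Data.Bool.Properties using (¬-not; not-injective)
open import Data.Empty using (⊥)
open import Data.Product using (∃; _×_; _,_; proj₁; proj₂)
open import Data.Product.Properties using () renaming (≡-dec to ×-≡-dec)
open import Data.Sum using (_⊎_; inj₁; inj₂)
open import Data.Fin using (Fin; toℕ; inject₁; fromℕ; fromℕ<) renaming (zero to fzero; suc to fsuc)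
open import Data.Fin.Properties using (injective⇒≤; toℕ-inject₁; toℕ-fromℕ; toℕ-fromℕ<; toℕ<n; toℕ-injective)
import Data.Fin.Properties as Finₚ
open import Data.Vec as Vec using (Vec; tabulate; zipWith)
open import Data.Vec.Properties using (last-∷ʳ; tabulate-cong; ∷-injective; lookup∘tabulate)
open import Data.List
  using (List; []; _∷_; [_]; _++_; length; map; concatMap; cartesianProductWith; applyUpTo; upTo; filter; lookup)
open import Data.List.Properties
  using (length-++; length-map; map-++; map-∘; map-cong; map-id; applyUpTo-∷ʳ; length-upTo; upTo-∷ʳ)
open import Data.List.Relation.Unary.All as All using (All; []; _∷_)
import Data.List.Relation.Unary.All.Properties as All
open import Data.List.Relation.Unary.AllPairs as AllPairs using (AllPairs; []; _∷_)
import Data.List.Relation.Unary.AllPairs.Properties as AllPairs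
open import Data.List.Relation.Unary.Any using (index; here; there)
open import Data.List.Relation.Unary.Any.Properties using (lookup-index)
open import Data.List.Relation.Unary.Unique.Propositional using (Unique)
open import Data.List.Relation.Unary.Unique.Propositional.Properties using (Unique[x∷xs]⇒x∉xs; upTo⁺)
import Data.List.Relation.Unary.Unique.Propositional.Properties as Unique
import Data.List.Relation.Unary.Unique.Setoid as SetoidUnique
import Data.List.Relation.Unary.Unique.Setoid.Properties as SetoidUniqueₚ
open import Data.List.Membership.Propositional using (_∈_; _∉_; find)
open import Data.List.Membership.Propositional.Properties
  using (∈-lookup; ∈-upTo⁺; ∈-upTo⁻; ∈-map⁺; ∈-map⁻; ∈-filter⁻; ∈-concatMap⁻; ∈-cartesianProductWith⁻)
open import Data.List.Membership.DecPropositional _≟_ using (_∈?_)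
open import Data.List.Relation.Binary.Subset.Propositional using (_⊆_)
open import Data.List.Relation.Binary.Disjoint.Propositional using (Disjoint)
open import Data.List.Relation.Binary.Sublist.Propositional
  using ([]; _∷_; _∷ʳ_) renaming (_⊆_ to _⊑_; lookup to ⊑-lookup)
open import Data.List.Relation.Binary.Sublist.Propositional.Properties using (All-resp-⊆; length-mono-≤)
open import Algebra.Properties.CommutativeSemigroup +-commutativeSemigroup
  using () renaming (interchange to +-interchange)
open import Algebra.Properties.CommutativeSemigroup *-commutativeSemigroup
  using () renaming (interchange to *-interchange)
open import Function using (_∘_; _on_)
open import Function.Bundles using (_⇔_; mk⇔; Equivalence)
open import Function.Definitions using (Injective)
open import Level using (0ℓ)
open import Relation.Binary using (Setoid; DecidableEquality)
open import Relation.Binary.PropositionalEquality hiding ([_])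
open import Relation.Nullary using (¬_; Dec; yes; no; does; contradiction; ¬?; _×-dec_; _⊎-dec_)
open import Relation.Nullary.Decidable using (dec-true; dec-false; does-⇔)
open import Relation.Unary using (Decidable)
open import Relation.Unary.Properties using (∁?)

private variable
  A B D : Set

does≡true⇒ : ∀ {P : Set} (p? : Dec P) → does p? ≡ true → P
does≡true⇒ (yes p) _  = p
does≡true⇒ (no _)  ()

-- Counting with lists

length-filter+∁ : ∀ {P : A → Set} (P? : Decidable P) xs →
                  length (filter P? xs) + length (filter (∁? P?) xs) ≡ length xs
length-filter+∁ P? []       = refl
length-filter+∁ P? (x ∷ xs) with P? x
... | yes _ = cong suc (length-filter+∁ P? xs)
... | no  _ = trans (+-suc _ _) (cong suc (length-filter+∁ P? xs))

lookup-injective : {xs : List A} → Unique xs → ∀ i j → lookup xs i ≡ lookup xs j → i ≡ j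
lookup-injective (_    ∷ _)   fzero    fzero    _  = refl
lookup-injective (x∉xs ∷ _)   fzero    (fsuc j) eq = contradiction eq (All.lookup x∉xs (∈-lookup j))
lookup-injective (x∉xs ∷ _)   (fsuc i) fzero    eq = contradiction (sym eq) (All.lookup x∉xs (∈-lookup i))
lookup-injective (_    ∷ xs!) (fsuc i) (fsuc j) eq = cong fsuc (lookup-injective xs! i j eq)

Unique⇒length≤ : {xs ys : List A} → Unique xs → xs ⊆ ys → length xs ≤ length ys
Unique⇒length≤ {xs = xs} {ys} xs! xs⊆ys = injective⇒≤ position-injective
  where
  position : Fin (length xs) → Fin (length ys)
  position i = index (xs⊆ys (∈-lookup i))

  position-injective : ∀ {i j} → position i ≡ position j → i ≡ j
  position-injective {i} {j} eq = lookup-injective xs! i j (begin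
    lookup xs i             ≡⟨ lookup-index (xs⊆ys (∈-lookup i)) ⟩
    lookup ys (position i)  ≡⟨ cong (lookup ys) eq ⟩
    lookup ys (position j)  ≡⟨ lookup-index (xs⊆ys (∈-lookup j)) ⟨
    lookup xs j             ∎)
    where open ≡-Reasoning

length-concatMap : (f : A → List B) (xs : List A) → length (concatMap f xs) ≡ sum (map (length ∘ f) xs)
length-concatMap f []       = refl
length-concatMap f (x ∷ xs) = trans (length-++ (f x)) (cong (length (f x) +_) (length-concatMap f xs))

length-cartesianProductWith : (f : A → B → D) (xs : List A) (ys : List B) →
                              length (cartesianProductWith f xs ys) ≡ length xs * length ys
length-cartesianProductWith f []       ys = refl
length-cartesianProductWith f (x ∷ xs) ys = begin
  length (map (f x) ys ++ cartesianProductWith f xs ys)          ≡⟨ length-++ (map (f x) ys) ⟩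
  length (map (f x) ys) + length (cartesianProductWith f xs ys)  ≡⟨ cong₂ _+_ (length-map (f x) ys) IH ⟩
  length ys + length xs * length ys                              ∎
  where
  open ≡-Reasoning
  IH = length-cartesianProductWith f xs ys

*-sum-mono-≤ : ∀ a b (f g : A → ℕ) xs → (∀ x → a * f x ≤ b * g x) → a * sum (map f xs) ≤ b * sum (map g xs)
*-sum-mono-≤ a b f g []       _ = ≤-reflexive (trans (*-zeroʳ a) (sym (*-zeroʳ b)))
*-sum-mono-≤ a b f g (x ∷ xs) h = begin
  a * (f x + sum (map f xs))      ≡⟨ *-distribˡ-+ a (f x) _ ⟩
  a * f x + a * sum (map f xs)    ≤⟨ +-mono-≤ (h x) (*-sum-mono-≤ a b f g xs h) ⟩
  b * g x + b * sum (map g xs)    ≡⟨ *-distribˡ-+ b (g x) _ ⟨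
  b * (g x + sum (map g xs))      ∎
  where open ≤-Reasoning

sum-upTo : ∀ n → sum (upTo n) ≡ n C 2
sum-upTo zero    = refl
sum-upTo (suc n) = begin
  sum (upTo (suc n))       ≡⟨ cong sum (upTo-∷ʳ n) ⟨
  sum (upTo n ++ [ n ])    ≡⟨ sum-++ (upTo n) [ n ] ⟩
  sum (upTo n) + (n + 0)   ≡⟨ cong₂ _+_ (sum-upTo n) (+-identityʳ n) ⟩
  n C 2 + n                ≡⟨ +-comm (n C 2) n ⟩
  n + n C 2                ≡⟨ cong (_+ n C 2) (nC1≡n n) ⟨
  n C 1 + n C 2            ≡⟨ nCk+nC[k+1]≡[n+1]C[k+1] n 1 ⟩
  suc n C 2                ∎
  where open ≡-Reasoning

upTo-increasing : ∀ n → AllPairs _<_ (upTo n)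
upTo-increasing n = AllPairs.applyUpTo⁺₁ (λ i → i) n (λ i<j _ → i<j)

AllPairs-resp-⊑ : ∀ {R : A → A → Set} {xs ys} → ys ⊑ xs → AllPairs R xs → AllPairs R ys
AllPairs-resp-⊑ []       []         = []
AllPairs-resp-⊑ (_ ∷ʳ τ) (_ ∷ rs)   = AllPairs-resp-⊑ τ rs
AllPairs-resp-⊑ (refl ∷ τ) (r ∷ rs) = All-resp-⊆ τ r ∷ AllPairs-resp-⊑ τ rs

allVecs : List A → (k : ℕ) → List (Vec A k)
allVecs xs zero    = [ Vec.[] ]
allVecs xs (suc k) = cartesianProductWith Vec._∷_ xs (allVecs xs k)

length-allVecs : ∀ (xs : List A) k → length (allVecs xs k) ≡ length xs ^ k
length-allVecs xs zero    = refl
length-allVecs xs (suc k) = trans (length-cartesianProductWith Vec._∷_ xs (allVecs xs k))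
                                  (cong (length xs *_) (length-allVecs xs k))

allVecs-unique : ∀ {xs : List A} → Unique xs → ∀ k → Unique (allVecs xs k)
allVecs-unique xs! zero    = [] ∷ []
allVecs-unique xs! (suc k) = Unique.cartesianProductWith⁺ Vec._∷_ ∷-injective xs! (allVecs-unique xs! k)

module _ (_≟ᴬ_ : DecidableEquality A) where

  bitAt : (ks : List A) → Vec Bool (length ks) → A → Bool
  bitAt []       Vec.[]         _ = false
  bitAt (k ∷ ks) (b Vec.∷ bs) a = if does (a ≟ᴬ k) then b else bitAt ks bs a

  bitAt-injective : ∀ {ks} → Unique ks → ∀ {bs bs′} → (∀ {k} → k ∈ ks → bitAt ks bs k ≡ bitAt ks bs′ k) → bs ≡ bs′
  bitAt-injective {[]}     _            {Vec.[]}     {Vec.[]}       _     = refl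
  bitAt-injective {k ∷ ks} (k∉ks ∷ ks!) {b Vec.∷ bs} {b′ Vec.∷ bs′} agree =
    cong₂ Vec._∷_ head-agree (bitAt-injective ks! tail-agree)
    where
    head-agree : b ≡ b′
    head-agree with agree (here refl)
    ... | eq rewrite dec-true (k ≟ᴬ k) refl = eq
    tail-agree : ∀ {k′} → k′ ∈ ks → bitAt ks bs k′ ≡ bitAt ks bs′ k′
    tail-agree {k′} k′∈ks with agree (there k′∈ks)
    ... | eq rewrite dec-false (k′ ≟ᴬ k) (All.lookup k∉ks k′∈ks ∘ sym) = eq

-- Binomial sums and Bell numbers

∑< : ℕ → (ℕ → ℕ) → ℕ
∑< n f = sum (applyUpTo f n)

∑<-cong : ∀ n {f g : ℕ → ℕ} → (∀ k → f k ≡ g k) → ∑< n f ≡ ∑< n g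
∑<-cong zero    f≗g = refl
∑<-cong (suc n) f≗g = cong₂ _+_ (f≗g 0) (∑<-cong n (f≗g ∘ suc))

∑<-distrib-+ : ∀ n (f g : ℕ → ℕ) → ∑< n (λ k → f k + g k) ≡ ∑< n f + ∑< n g
∑<-distrib-+ zero    f g = refl
∑<-distrib-+ (suc n) f g = begin
  f 0 + g 0 + ∑< n (λ k → f (suc k) + g (suc k))  ≡⟨ cong (f 0 + g 0 +_) (∑<-distrib-+ n (f ∘ suc) (g ∘ suc)) ⟩
  f 0 + g 0 + (∑< n (f ∘ suc) + ∑< n (g ∘ suc))   ≡⟨ +-interchange (f 0) (g 0) _ _ ⟩
  ∑< (suc n) f + ∑< (suc n) g                      ∎
  where open ≡-Reasoning

∑<-last : ∀ n (f : ℕ → ℕ) → ∑< (suc n) f ≡ ∑< n f + f n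
∑<-last n f = begin
  sum (applyUpTo f (suc n))        ≡⟨ cong sum (applyUpTo-∷ʳ f n) ⟨
  sum (applyUpTo f n ++ [ f n ])   ≡⟨ sum-++ (applyUpTo f n) [ f n ] ⟩
  ∑< n f + (f n + 0)               ≡⟨ cong (∑< n f +_) (+-identityʳ (f n)) ⟩
  ∑< n f + f n                     ∎
  where open ≡-Reasoning

binomialSum : ℕ → (ℕ → ℕ) → ℕ
binomialSum m h = ∑< (suc m) (λ k → (m C k) * h k)

binomialSum-suc : ∀ m (h : ℕ → ℕ) → binomialSum (suc m) h ≡ binomialSum m h + binomialSum m (h ∘ suc)
binomialSum-suc m h = begin
  h₀ + ∑< (suc m) (λ k → (suc m C suc k) * h (suc k))
    ≡⟨ cong (h₀ +_) (trans (∑<-cong (suc m) pascal) (∑<-distrib-+ (suc m) T U)) ⟩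
  h₀ + (∑< (suc m) T + ∑< (suc m) U)
    ≡⟨ cong (λ t → h₀ + (∑< (suc m) T + t)) (trans (∑<-last m U) last-vanishes) ⟩
  h₀ + (∑< (suc m) T + ∑< m U)
    ≡⟨ cong (h₀ +_) (+-comm (∑< (suc m) T) (∑< m U)) ⟩
  h₀ + (∑< m U + ∑< (suc m) T)
    ≡⟨ +-assoc h₀ (∑< m U) (∑< (suc m) T) ⟨
  h₀ + ∑< m U + ∑< (suc m) T
    ∎
  where
  open ≡-Reasoning
  h₀ = 1 * h 0
  T U : ℕ → ℕ
  T k = (m C k) * h (suc k)
  U k = (m C suc k) * h (suc k)
  pascal : ∀ k → (suc m C suc k) * h (suc k) ≡ T k + U k
  pascal k = trans (cong (_* h (suc k)) (sym (nCk+nC[k+1]≡[n+1]C[k+1] m k))) (*-distribʳ-+ (h (suc k)) (m C k) _)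
  last-vanishes : ∑< m U + U m ≡ ∑< m U
  last-vanishes = trans (cong (λ c → ∑< m U + c * h (suc m)) (k>n⇒nCk≡0 (n<1+n m))) (+-identityʳ _)

tabulate-∷ʳ : ∀ {n} (f : Fin (suc n) → A) → tabulate f ≡ tabulate (f ∘ inject₁) Vec.∷ʳ f (fromℕ n)
tabulate-∷ʳ {n = zero}  f = refl
tabulate-∷ʳ {n = suc n} f = cong (f fzero Vec.∷_) (tabulate-∷ʳ (f ∘ fsuc))

bellVec≡tabulate : ∀ m → bellVec m ≡ tabulate (Bell ∘ toℕ)
bellVec≡tabulate zero    = refl
bellVec≡tabulate (suc m) = begin
  bellVec (suc m)
    ≡⟨ cong (bellVec m Vec.∷ʳ_) (sym (last-∷ʳ _ (bellVec m))) ⟩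
  bellVec m Vec.∷ʳ Bell (suc m)
    ≡⟨ cong₂ Vec._∷ʳ_ (bellVec≡tabulate m) (cong Bell (sym (toℕ-fromℕ (suc m)))) ⟩
  tabulate (Bell ∘ toℕ) Vec.∷ʳ Bell (toℕ (fromℕ (suc m)))
    ≡⟨ cong (Vec._∷ʳ Bell (toℕ (fromℕ (suc m)))) (tabulate-cong (cong Bell ∘ sym ∘ toℕ-inject₁)) ⟩
  tabulate (Bell ∘ toℕ ∘ inject₁) Vec.∷ʳ Bell (toℕ (fromℕ (suc m)))
    ≡⟨ tabulate-∷ʳ (Bell ∘ toℕ) ⟨
  tabulate (Bell ∘ toℕ)
    ∎
  where open ≡-Reasoning

sum-zipWith-tabulate : ∀ n (f g : ℕ → ℕ) →
  Vec.sum (zipWith _*_ (tabulate {n = n} (f ∘ toℕ)) (tabulate (g ∘ toℕ))) ≡ ∑< n (λ k → f k * g k)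
sum-zipWith-tabulate zero    f g = refl
sum-zipWith-tabulate (suc n) f g = cong (f 0 * g 0 +_) (sum-zipWith-tabulate n (f ∘ suc) (g ∘ suc))

Bell-suc : ∀ m → Bell (suc m) ≡ binomialSum m Bell
Bell-suc m = begin
  Bell (suc m)                                            ≡⟨ last-∷ʳ _ (bellVec m) ⟩
  Vec.sum (zipWith _*_ binomials (bellVec m))             ≡⟨ cong (Vec.sum ∘ zipWith _*_ binomials) (bellVec≡tabulate m) ⟩
  Vec.sum (zipWith _*_ binomials (tabulate (Bell ∘ toℕ))) ≡⟨ sum-zipWith-tabulate (suc m) (m C_) Bell ⟩
  binomialSum m Bell                                      ∎
  where
  open ≡-Reasoning
  binomials : Vec ℕ (suc m)
  binomials = tabulate (λ k → m C toℕ k)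

-- Sublists and set partitions

module _ {x : A} {xs : List A} where

  skip keep : ∃ (_⊑ xs) → ∃ (_⊑ x ∷ xs)
  skip (ys , τ) = ys , x ∷ʳ τ
  keep (ys , τ) = x ∷ ys , refl ∷ τ

sublists : (xs : List A) → List (∃ (_⊑ xs))
sublists []       = [ [] , [] ]
sublists (x ∷ xs) = map skip (sublists xs) ++ map keep (sublists xs)

sum-sublists : ∀ (h : ℕ → ℕ) (xs : List A) →
               sum (map (h ∘ length ∘ proj₁) (sublists xs)) ≡ binomialSum (length xs) h
sum-sublists h []       = cong (_+ 0) (sym (*-identityˡ (h 0)))
sum-sublists h (x ∷ xs) = begin
  sum (map F (map skip S ++ map keep S))
    ≡⟨ cong sum (map-++ F (map skip S) (map keep S)) ⟩
  sum (map F (map skip S) ++ map F (map keep S))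
    ≡⟨ sum-++ (map F (map skip S)) (map F (map keep S)) ⟩
  sum (map F (map skip S)) + sum (map F (map keep S))
    ≡⟨ cong₂ (λ s t → sum s + sum t) (map-∘ S) (map-∘ S) ⟨
  sum (map (h ∘ length ∘ proj₁) S) + sum (map (h ∘ suc ∘ length ∘ proj₁) S)
    ≡⟨ cong₂ _+_ (sum-sublists h xs) (sum-sublists (h ∘ suc) xs) ⟩
  binomialSum (length xs) h + binomialSum (length xs) (h ∘ suc)
    ≡⟨ binomialSum-suc (length xs) h ⟨
  binomialSum (length (x ∷ xs)) h
    ∎
  where
  open ≡-Reasoning
  S = sublists xs
  F : ∃ (_⊑ x ∷ xs) → ℕ
  F = h ∘ length ∘ proj₁

Separated : List A → List A → Set
Separated ys zs = ∃ λ w → (w ∈ ys × w ∉ zs) ⊎ (w ∉ ys × w ∈ zs)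

sublists-separated : {xs : List A} → Unique xs → AllPairs (Separated on proj₁) (sublists xs)
sublists-separated {xs = []}     _                 = [] ∷ []
sublists-separated {xs = x ∷ xs} x∷xs!@(_ ∷ xs!) =
  AllPairs.++⁺ (AllPairs.map⁺ IH) (AllPairs.map⁺ (AllPairs.map (λ {a} {b} → keep-separated {a} {b}) IH))
               (All.map⁺ (All.universal (λ a → All.map⁺ (All.universal (skip-keep-separated a) S)) S))
  where
  S = sublists xs
  IH = sublists-separated xs!
  x∉ : ∀ {ys} → ys ⊑ xs → x ∉ ys
  x∉ τ = Unique[x∷xs]⇒x∉xs x∷xs! ∘ ⊑-lookup τ
  skip-keep-separated : ∀ (a b : ∃ (_⊑ xs)) → Separated (proj₁ a) (x ∷ proj₁ b)
  skip-keep-separated (ys , τ) _ = x , inj₂ (x∉ τ , here refl)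
  keep-separated : ∀ {a b : ∃ (_⊑ xs)} → Separated (proj₁ a) (proj₁ b) → Separated (x ∷ proj₁ a) (x ∷ proj₁ b)
  keep-separated {ys , τ} {zs , σ} (w , inj₁ (w∈ys , w∉zs)) =
    w , inj₁ (there w∈ys , λ { (here refl) → x∉ τ w∈ys ; (there w∈zs) → w∉zs w∈zs })
  keep-separated {ys , τ} {zs , σ} (w , inj₂ (w∉ys , w∈zs)) =
    w , inj₂ ((λ { (here refl) → x∉ σ w∈zs ; (there w∈ys) → w∉ys w∈ys }) , there w∈zs)

-- A partition of X is represented by the map sending each element to the least element of its
-- block, extended by the identity outside X.
record Partition (X : List ℕ) : Set where
  field
    rep      : ℕ → ℕ
    rep-≤    : ∀ w → rep w ≤ w
    rep-idem : ∀ w → rep (rep w) ≡ rep w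
    rep-∉    : ∀ {w} → w ∉ X → rep w ≡ w
    rep-∈    : ∀ {w} → w ∈ X → rep w ∈ X

open Partition

partitionSetoid : List ℕ → Setoid 0ℓ 0ℓ
partitionSetoid X = record
  { Carrier       = Partition X
  ; _≈_           = λ p q → ∀ w → rep p w ≡ rep q w
  ; isEquivalence = record
    { refl  = λ _ → refl
    ; sym   = λ p≈q w → sym (p≈q w)
    ; trans = λ p≈q q≈r w → trans (p≈q w) (q≈r w)
    }
  }

module _ {X : List ℕ} where
  open Setoid (partitionSetoid X) public using () renaming (_≈_ to _≈ᴾ_; _≉_ to _≉ᴾ_)

rep≢⇒∈ : ∀ {X} (p : Partition X) {w} → rep p w ≢ w → w ∈ X
rep≢⇒∈ {X} p {w} moved with w ∈? X
... | yes w∈X = w∈X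
... | no  w∉X = contradiction (rep-∉ p w∉X) moved

discrete : ∀ {X} → Partition X
discrete = record
  { rep = λ w → w ; rep-≤ = λ _ → ≤-refl ; rep-idem = λ _ → refl ; rep-∉ = λ _ → refl ; rep-∈ = λ w∈X → w∈X }

module Extend {x : ℕ} {xs : List ℕ} (x<xs : All (x <_) xs) {R : List ℕ} (τ : R ⊑ xs) where

  x∉R : x ∉ R
  x∉R x∈R = <-irrefl refl (All.lookup x<xs (⊑-lookup τ x∈R))

  x≤ : ∀ {w} → w ∈ x ∷ xs → x ≤ w
  x≤ (here refl)  = ≤-refl
  x≤ (there w∈xs) = <⇒≤ (All.lookup x<xs w∈xs)

  -- R is partitioned by the given partition, and the other elements of x ∷ xs form the block of x.
  extendRep : Partition R → ℕ → ℕ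
  extendRep q w with w ∈? R | w ∈? x ∷ xs
  ... | yes _ | _     = rep q w
  ... | no  _ | yes _ = x
  ... | no  _ | no  _ = w

  module _ (q : Partition R) where

    extendRep-∈ : ∀ {w} → w ∈ R → extendRep q w ≡ rep q w
    extendRep-∈ {w} w∈R with w ∈? R | w ∈? x ∷ xs
    ... | yes _   | _ = refl
    ... | no  w∉R | _ = contradiction w∈R w∉R

    extendRep-block : ∀ {w} → w ∉ R → w ∈ x ∷ xs → extendRep q w ≡ x
    extendRep-block {w} w∉R w∈ with w ∈? R | w ∈? x ∷ xs
    ... | yes w∈R | _     = contradiction w∈R w∉R
    ... | no  _   | yes _ = refl
    ... | no  _   | no w∉ = contradiction w∈ w∉

    extendRep-∉ : ∀ {w} → w ∉ x ∷ xs → extendRep q w ≡ w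
    extendRep-∉ {w} w∉ with w ∈? R | w ∈? x ∷ xs
    ... | yes w∈R | _     = contradiction (there (⊑-lookup τ w∈R)) w∉
    ... | no  _   | yes w∈ = contradiction w∈ w∉
    ... | no  _   | no  _ = refl

    extend : Partition (x ∷ xs)
    extend = record { rep = extendRep q ; rep-≤ = ≤ ; rep-idem = idem ; rep-∉ = extendRep-∉ ; rep-∈ = ∈ }
      where
      ≤ : ∀ w → extendRep q w ≤ w
      ≤ w with w ∈? R | w ∈? x ∷ xs
      ... | yes _ | _      = rep-≤ q w
      ... | no  _ | yes w∈ = x≤ w∈
      ... | no  _ | no  _  = ≤-refl

      idem : ∀ w → extendRep q (extendRep q w) ≡ extendRep q w
      idem w with w ∈? R | w ∈? x ∷ xs
      ... | yes w∈R | _     = trans (extendRep-∈ (rep-∈ q w∈R)) (rep-idem q w)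
      ... | no  _   | yes _ = extendRep-block x∉R (here refl)
      ... | no  _   | no w∉ = extendRep-∉ w∉

      ∈ : ∀ {w} → w ∈ x ∷ xs → extendRep q w ∈ x ∷ xs
      ∈ {w} w∈ with w ∈? R | w ∈? x ∷ xs
      ... | yes w∈R | _     = there (⊑-lookup τ (rep-∈ q w∈R))
      ... | no  _   | yes _ = here refl
      ... | no  _   | no w∉ = contradiction w∈ w∉

  extend-injective : ∀ {q q′} → extend q ≈ᴾ extend q′ → q ≈ᴾ q′
  extend-injective {q} {q′} eq w with w ∈? R
  ... | yes w∈R = trans (sym (extendRep-∈ q w∈R)) (trans (eq w) (extendRep-∈ q′ w∈R))
  ... | no  w∉R = trans (rep-∉ q w∉R) (sym (rep-∉ q′ w∉R))

open Extend using (extend; extend-injective; extendRep-∈; extendRep-block; x∉R)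

-- An element of R outside R′ is represented inside R by the first extension and by x ∉ R by the second.
extend-separated : ∀ {x xs R R′} (x<xs : All (x <_) xs) (τ : R ⊑ xs) (τ′ : R′ ⊑ xs) → Separated R R′ →
                   (q : Partition R) (q′ : Partition R′) → extend x<xs τ q ≉ᴾ extend x<xs τ′ q′
extend-separated {x} x<xs τ τ′ (w , inj₁ (w∈R , w∉R′)) q q′ eq =
  x∉R x<xs τ (subst (_∈ _) rep≡x (rep-∈ q w∈R))
  where
  rep≡x : rep q w ≡ x
  rep≡x = trans (sym (extendRep-∈ x<xs τ q w∈R))
                (trans (eq w) (extendRep-block x<xs τ′ q′ w∉R′ (there (⊑-lookup τ w∈R))))
extend-separated {x} x<xs τ τ′ (w , inj₂ (w∉R , w∈R′)) q q′ eq =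
  x∉R x<xs τ′ (subst (_∈ _) rep≡x (rep-∈ q′ w∈R′))
  where
  rep≡x : rep q′ w ≡ x
  rep≡x = trans (sym (extendRep-∈ x<xs τ′ q′ w∈R′))
                (trans (sym (eq w)) (extendRep-block x<xs τ q w∉R (there (⊑-lookup τ′ w∈R′))))

-- The recursion descends to sublists, so it is bounded by a fuel argument; any fuel ≥ length X will do.
partitions : ℕ → (X : List ℕ) → AllPairs _<_ X → List (Partition X)
partitions _          []       _               = [ discrete ]
partitions zero       (_ ∷ _)  _               = []
partitions (suc fuel) (x ∷ xs) (x<xs ∷ sorted) =
  concatMap (λ (R , τ) → map (extend x<xs τ) (partitions fuel R (AllPairs-resp-⊑ τ sorted))) (sublists xs)

length-partitions : ∀ fuel X (sorted : AllPairs _<_ X) → length X ≤ fuel →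
                    length (partitions fuel X sorted) ≡ Bell (length X)
length-partitions _          []       _                _          = refl
length-partitions (suc fuel) (x ∷ xs) (x<xs ∷ sorted) (s≤s |xs|≤fuel) = begin
  length (concatMap blocks (sublists xs))            ≡⟨ length-concatMap blocks (sublists xs) ⟩
  sum (map (length ∘ blocks) (sublists xs))          ≡⟨ cong sum (map-cong length-blocks (sublists xs)) ⟩
  sum (map (Bell ∘ length ∘ proj₁) (sublists xs))    ≡⟨ sum-sublists Bell xs ⟩
  binomialSum (length xs) Bell                       ≡⟨ Bell-suc (length xs) ⟨
  Bell (length (x ∷ xs))                             ∎
  where
  open ≡-Reasoning
  blocks : ∃ (_⊑ xs) → List (Partition (x ∷ xs))
  blocks (R , τ) = map (extend x<xs τ) (partitions fuel R (AllPairs-resp-⊑ τ sorted))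
  length-blocks : ∀ s → length (blocks s) ≡ Bell (length (proj₁ s))
  length-blocks (R , τ) = trans (length-map _ (partitions fuel R _))
    (length-partitions fuel R _ (≤-trans (length-mono-≤ τ) |xs|≤fuel))

partitions-unique : ∀ fuel X (sorted : AllPairs _<_ X) →
                    SetoidUnique.Unique (partitionSetoid X) (partitions fuel X sorted)
partitions-unique _          []       _               = [] ∷ []
partitions-unique zero       (_ ∷ _)  _               = []
partitions-unique (suc fuel) (x ∷ xs) (x<xs ∷ sorted) =
  AllPairs.concat⁺ (All.map⁺ (All.universal blocks-unique (sublists xs)))
                   (AllPairs.map⁺ (AllPairs.map separated (sublists-separated (AllPairs.map <⇒≢ sorted))))
  where
  parts : (s : ∃ (_⊑ xs)) → List (Partition (proj₁ s))
  parts (R , τ) = partitions fuel R (AllPairs-resp-⊑ τ sorted)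
  blocks : ∃ (_⊑ xs) → List (Partition (x ∷ xs))
  blocks s = map (extend x<xs (proj₂ s)) (parts s)
  blocks-unique : ∀ s → SetoidUnique.Unique (partitionSetoid (x ∷ xs)) (blocks s)
  blocks-unique (R , τ) = AllPairs.map⁺ (AllPairs.map (_∘ extend-injective x<xs τ) (partitions-unique fuel R _))
  separated : ∀ {s s′} → Separated (proj₁ s) (proj₁ s′) → All (λ p → All (p ≉ᴾ_) (blocks s′)) (blocks s)
  separated {R , τ} {R′ , τ′} sep = All.map⁺ (All.universal
    (λ q → All.map⁺ (All.universal (extend-separated x<xs τ τ′ sep q) (parts (R′ , τ′)))) (parts (R , τ)))

-- Star forests and even cycles

module StarForest (c : ℕ → ℕ) where

  -- The star forest whose stars are the blocks of c, centred at the fixed points of c.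
  Star : ℕ → ℕ → Set
  Star a b = a ≢ b × (c a ≡ b ⊎ c b ≡ a)

  star? : ∀ a b → Dec (Star a b)
  star? a b = ¬? (a ≟ b) ×-dec (c a ≟ b ⊎-dec c b ≟ a)

  star-sym : ∀ {a b} → Star a b → Star b a
  star-sym (a≢b , inj₁ ca≡b) = a≢b ∘ sym , inj₂ ca≡b
  star-sym (a≢b , inj₂ cb≡a) = a≢b ∘ sym , inj₁ cb≡a

  module _ (c-idem : ∀ a → c (c a) ≡ c a) where

    star-sameCentre : ∀ {a b} → Star a b → c a ≡ c b
    star-sameCentre {a}     (_ , inj₁ ca≡b) = trans (sym (c-idem a)) (cong c ca≡b)
    star-sameCentre {b = b} (_ , inj₂ cb≡a) = trans (cong c (sym cb≡a)) (c-idem b)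

    star-centre : ∀ {a b} → Star a b → c a ≡ a ⊎ c a ≡ b
    star-centre (_ , inj₁ ca≡b)     = inj₂ ca≡b
    star-centre ab@(_ , inj₂ cb≡a) = inj₁ (trans (star-sameCentre ab) cb≡a)

    -- The centre c a of the common star would lie in {a, b}, in {b, e} and in {e, f}.
    star-noPath₃ : ∀ {a b e f} → Star a b → Star b e → Star e f → a ≢ e → b ≢ f → ⊥
    star-noPath₃ {a} ab be ef a≢e b≢f with star-centre ab
    ... | inj₁ ca≡a with star-centre be
    ...   | inj₁ cb≡b = proj₁ ab (trans (sym ca≡a) (trans (star-sameCentre ab) cb≡b))
    ...   | inj₂ cb≡e = a≢e (trans (sym ca≡a) (trans (star-sameCentre ab) cb≡e))
    star-noPath₃ {a} ab be ef a≢e b≢f | inj₂ ca≡b with star-centre ef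
    ...   | inj₁ ce≡e = proj₁ be (trans (sym ca≡b) (trans (star-sameCentre ab) (trans (star-sameCentre be) ce≡e)))
    ...   | inj₂ ce≡f = b≢f (trans (sym ca≡b) (trans (star-sameCentre ab) (trans (star-sameCentre be) ce≡f)))

-- One step around the cycle 0 → 1 → ⋯ → k - 1 → 0; step does not check suc a < k, callers supply bounds.
data CycleStep (k : ℕ) : ℕ → ℕ → Set where
  step : ∀ {a} → CycleStep k a (suc a)
  wrap : ∀ {a} → suc a ≡ k → CycleStep k a 0

cycAdj⇒step : ∀ {k} {i j : Fin k} → CycAdj k i j →
              CycleStep k (toℕ i) (toℕ j) ⊎ CycleStep k (toℕ j) (toℕ i)
cycAdj⇒step (inj₁ i+1≡j)                     = inj₁ (subst (CycleStep _ _) i+1≡j step)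
cycAdj⇒step (inj₂ (inj₁ j+1≡i))              = inj₂ (subst (CycleStep _ _) j+1≡i step)
cycAdj⇒step (inj₂ (inj₂ (inj₁ (i≡0 , j+1≡k)))) = inj₂ (subst (CycleStep _ _) (sym i≡0) (wrap j+1≡k))
cycAdj⇒step (inj₂ (inj₂ (inj₂ (j≡0 , i+1≡k)))) = inj₁ (subst (CycleStep _ _) (sym j≡0) (wrap i+1≡k))

step-functional : ∀ {k a b b′} → b < k → b′ < k → CycleStep k a b → CycleStep k a b′ → b ≡ b′
step-functional _   _    step        step        = refl
step-functional b<k _    step        (wrap refl) = contradiction b<k (<-irrefl refl)
step-functional _   b′<k (wrap refl) step        = contradiction b′<k (<-irrefl refl)
step-functional _   _    (wrap _)    (wrap _)    = refl

step-injective : ∀ {k a a′ b} → CycleStep k a b → CycleStep k a′ b → a ≡ a′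
step-injective step         step          = refl
step-injective (wrap a+1≡k) (wrap a′+1≡k) = suc-injective (trans a+1≡k (sym a′+1≡k))

-- Four steps return to the start only if k divides 4.
step-noClosedWalk₄ : ∀ {k a b e f} → 5 ≤ k →
                     CycleStep k a b → CycleStep k b e → CycleStep k e f → CycleStep k f a → ⊥
step-noClosedWalk₄ 5≤k step        step        step        (wrap refl) with 5≤k
... | s≤s (s≤s (s≤s (s≤s ())))
step-noClosedWalk₄ 5≤k step        step        (wrap refl) step        with 5≤k
... | s≤s (s≤s (s≤s (s≤s ())))
step-noClosedWalk₄ 5≤k step        step        (wrap refl) (wrap ())
step-noClosedWalk₄ 5≤k step        (wrap refl) step        step        with 5≤k
... | s≤s (s≤s (s≤s (s≤s ())))
step-noClosedWalk₄ 5≤k step        (wrap refl) step        (wrap refl) with 5≤k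
... | s≤s (s≤s ())
step-noClosedWalk₄ 5≤k step        (wrap refl) (wrap ())   _
step-noClosedWalk₄ 5≤k (wrap refl) step        step        step        with 5≤k
... | s≤s (s≤s (s≤s (s≤s ())))
step-noClosedWalk₄ 5≤k (wrap refl) step        step        (wrap ())
step-noClosedWalk₄ 5≤k (wrap refl) step        (wrap refl) _           with 5≤k
... | s≤s (s≤s ())
step-noClosedWalk₄ 5≤k (wrap refl) (wrap refl) _           _           with 5≤k
... | s≤s ()

cycAdj-noCommonNeighbours : ∀ {k} {i j a b : Fin k} → 5 ≤ k → i ≢ j → a ≢ b →
                            CycAdj k i a → CycAdj k i b → CycAdj k j a → CycAdj k j b → ⊥
cycAdj-noCommonNeighbours {i = i} {j} {a} {b} 5≤k i≢j a≢b ia ib ja jb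
  with cycAdj⇒step ia | cycAdj⇒step ib
... | inj₁ i→a | inj₁ i→b = a≢b (toℕ-injective (step-functional (toℕ<n a) (toℕ<n b) i→a i→b))
... | inj₂ a→i | inj₂ b→i = a≢b (toℕ-injective (step-injective a→i b→i))
... | inj₁ i→a | inj₂ b→i with cycAdj⇒step ja | cycAdj⇒step jb
...   | inj₁ j→a | _        = i≢j (toℕ-injective (step-injective i→a j→a))
...   | inj₂ a→j | inj₂ b→j = i≢j (toℕ-injective (step-functional (toℕ<n i) (toℕ<n j) b→i b→j))
...   | inj₂ a→j | inj₁ j→b = step-noClosedWalk₄ 5≤k i→a a→j j→b b→i
cycAdj-noCommonNeighbours {i = i} {j} 5≤k i≢j a≢b ia ib ja jb | inj₂ a→i | inj₁ i→b
  with cycAdj⇒step ja | cycAdj⇒step jb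
...   | _        | inj₁ j→b = i≢j (toℕ-injective (step-injective i→b j→b))
...   | inj₂ a→j | _        = i≢j (toℕ-injective (step-functional (toℕ<n i) (toℕ<n j) a→i a→j))
...   | inj₁ j→a | inj₂ b→j = step-noClosedWalk₄ 5≤k i→b b→j j→a a→i

parity-suc : ∀ n → parity (suc n) ≡ parity n ⁻¹
parity-suc n = sym (⁻¹-selfInverse (suc-homo-⁻¹ n))

step-parity : ∀ {l a b} → CycleStep (2 * l) a b → parity a ≢ parity b
step-parity {a = a} step pa≡pa+1 = p≢p⁻¹ (parity a) (trans pa≡pa+1 (parity-suc a))
step-parity {l} {a} (wrap a+1≡2l) pa≡0 = p≢p⁻¹ (parity a) (begin
  parity a          ≡⟨ pa≡0 ⟩
  0ℙ                ≡⟨ *-homo-* 2 l ⟨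
  parity (2 * l)    ≡⟨ cong parity a+1≡2l ⟨
  parity (suc a)    ≡⟨ parity-suc a ⟩
  parity a ⁻¹       ∎)
  where open ≡-Reasoning

cycAdj-parity : ∀ {l} {i j : Fin (2 * l)} → CycAdj (2 * l) i j → parity (toℕ i) ≢ parity (toℕ j)
cycAdj-parity {l} ij with cycAdj⇒step ij
... | inj₁ i→j = step-parity {l} i→j
... | inj₂ j→i = step-parity {l} j→i ∘ sym

adjMatrix : (n : ℕ) → (ℕ → ℕ → Bool) → AdjMatrix n
adjMatrix n f = tabulate λ i → tabulate λ j → f (toℕ i) (toℕ j)

lookup-adjMatrix : ∀ {n} f (i j : Fin n) → Vec.lookup (Vec.lookup (adjMatrix n f) i) j ≡ f (toℕ i) (toℕ j)
lookup-adjMatrix f i j = trans (cong (λ row → Vec.lookup row j) (lookup∘tabulate _ i)) (lookup∘tabulate _ j)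

adjMatrix-simple : ∀ {n f} → (∀ x y → f x y ≡ f y x) → (∀ x → f x x ≡ false) → IsSimpleGraph (adjMatrix n f)
adjMatrix-simple {f = f} f-sym f-irrefl =
    (λ a b → trans (lookup-adjMatrix f a b) (trans (f-sym _ _) (sym (lookup-adjMatrix f b a))))
  , (λ a → trans (lookup-adjMatrix f a a) (f-irrefl _))

adjMatrix-injective : ∀ {n f g x y} → adjMatrix n f ≡ adjMatrix n g → x < n → y < n → f x y ≡ g x y
adjMatrix-injective {n} {f} {g} eq x<n y<n =
  subst₂ (λ x y → f x y ≡ g x y) (toℕ-fromℕ< x<n) (toℕ-fromℕ< y<n) (begin
    f (toℕ i) (toℕ j)                           ≡⟨ lookup-adjMatrix f i j ⟨
    Vec.lookup (Vec.lookup (adjMatrix n f) i) j ≡⟨ cong (λ M → Vec.lookup (Vec.lookup M i) j) eq ⟩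
    Vec.lookup (Vec.lookup (adjMatrix n g) i) j ≡⟨ lookup-adjMatrix g i j ⟩
    g (toℕ i) (toℕ j)                           ∎)
  where
  open ≡-Reasoning
  i = fromℕ< x<n
  j = fromℕ< y<n

-- Vertices are split into d = d′ + 1 classes by their residue modulo d; a vertex x has index x / d in its class.
module Construction (d′ : ℕ) where

  d : ℕ
  d = suc d′

  module Adjacency (c : ℕ → ℕ) (cross : ℕ → ℕ → Bool) where
    open StarForest c public

    inClass : ℕ → ℕ → ℕ → Bool
    inClass zero    a b = not (does (star? a b))
    inClass (suc _) _ _ = true

    adj : ℕ → ℕ → Bool
    adj x y = if does (x ≟ y) then false
              else if does (x % d ≟ y % d) then inClass (x % d) (x / d) (y / d)
              else cross x y

    inClass-sym : ∀ r a b → inClass r a b ≡ inClass r b a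
    inClass-sym zero    a b = cong not (does-⇔ (mk⇔ star-sym star-sym) (star? a b) (star? b a))
    inClass-sym (suc _) _ _ = refl

    inClass≡false : ∀ {r a b} → inClass r a b ≡ false → r ≡ 0 × Star a b
    inClass≡false {zero} {a} {b} eq = refl , does≡true⇒ (star? a b) (not-injective eq)

    inClass₀-nonStar : ∀ {a b} → ¬ Star a b → inClass 0 a b ≡ true
    inClass₀-nonStar {a} {b} ¬ab = cong not (dec-false (star? a b) ¬ab)

    adj-irrefl : ∀ x → adj x x ≡ false
    adj-irrefl x rewrite dec-true (x ≟ x) refl = refl

    adj-sym : (∀ x y → cross x y ≡ cross y x) → ∀ x y → adj x y ≡ adj y x
    adj-sym cross-sym x y with x ≟ y
    ... | yes refl = refl
    ... | no x≢y rewrite dec-false (x ≟ y) x≢y | dec-false (y ≟ x) (x≢y ∘ sym) with x % d ≟ y % d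
    ...   | yes same rewrite dec-true (x % d ≟ y % d) same | dec-true (y % d ≟ x % d) (sym same) =
      trans (cong (λ r → inClass r (x / d) (y / d)) same) (inClass-sym (y % d) (x / d) (y / d))
    ...   | no  diff rewrite dec-false (x % d ≟ y % d) diff | dec-false (y % d ≟ x % d) (diff ∘ sym) =
      cross-sym x y

    adj-inClass : ∀ {x y} → x ≢ y → x % d ≡ y % d → adj x y ≡ inClass (x % d) (x / d) (y / d)
    adj-inClass {x} {y} x≢y same rewrite dec-false (x ≟ y) x≢y | dec-true (x % d ≟ y % d) same = refl

    adj-cross : ∀ {x y} → x % d ≢ y % d → adj x y ≡ cross x y
    adj-cross {x} {y} diff
      rewrite dec-false (x ≟ y) (diff ∘ cong (_% d)) | dec-false (x % d ≟ y % d) diff = refl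

    graph : (n : ℕ) → AdjMatrix n
    graph n = adjMatrix n adj

    module InducedCycle (c-idem : ∀ a → c (c a) ≡ c a) (1≤d′ : 1 ≤ d′) {n : ℕ}
                        (v : Fin (2 * suc d) → Fin n) (v-injective : Injective _≡_ _≡_ v)
                        (v-adj : ∀ p q → Adj (graph n) (v p) (v q) ⇔ CycAdj (2 * suc d) p q) where

      X : Fin (2 * suc d) → ℕ
      X p = toℕ (v p)

      z : Fin (2 * suc d) → ℕ
      z p = X p / d

      adj⇔cycAdj : ∀ p q → adj (X p) (X q) ≡ true ⇔ CycAdj (2 * suc d) p q
      adj⇔cycAdj p q = mk⇔ (Equivalence.to (v-adj p q) ∘ trans (lookup-adjMatrix adj (v p) (v q)))
                           (trans (sym (lookup-adjMatrix adj (v p) (v q))) ∘ Equivalence.from (v-adj p q))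

      X-injective : ∀ {p q} → p ≢ q → X p ≢ X q
      X-injective p≢q = p≢q ∘ v-injective ∘ toℕ-injective

      class₀-index-injective : ∀ {p q} → p ≢ q → X p % d ≡ 0 → X q % d ≡ 0 → z p ≢ z q
      class₀-index-injective {p} {q} p≢q p₀ q₀ zp≡zq = X-injective p≢q (begin
        X p                ≡⟨ m≡m%n+[m/n]*n (X p) d ⟩
        X p % d + z p * d  ≡⟨ cong₂ (λ r t → r + t * d) (trans p₀ (sym q₀)) zp≡zq ⟩
        X q % d + z q * d  ≡⟨ m≡m%n+[m/n]*n (X q) d ⟨
        X q                ∎)
        where open ≡-Reasoning

      -- Equal parity rules out adjacency on the cycle, so the vertices are non-adjacent in the graph.
      sameClass⇒star : ∀ {p q} → p ≢ q → X p % d ≡ X q % d → parity (toℕ p) ≡ parity (toℕ q) →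
                       X p % d ≡ 0 × Star (z p) (z q)
      sameClass⇒star {p} {q} p≢q same par =
        inClass≡false (trans (sym (adj-inClass (X-injective p≢q) same)) nonadjacent)
        where
        nonadjacent : adj (X p) (X q) ≡ false
        nonadjacent = ¬-not λ pq → cycAdj-parity {suc d} (Equivalence.to (adj⇔cycAdj p q) pq) par

      nonStar⇒cycAdj : ∀ {p q} → p ≢ q → X p % d ≡ 0 → X q % d ≡ 0 → ¬ Star (z p) (z q) →
                       CycAdj (2 * suc d) p q
      nonStar⇒cycAdj {p} {q} p≢q p₀ q₀ ¬star = Equivalence.to (adj⇔cycAdj p q) (begin
        adj (X p) (X q)                ≡⟨ adj-inClass (X-injective p≢q) (trans p₀ (sym q₀)) ⟩
        inClass (X p % d) (z p) (z q)  ≡⟨ cong (λ r → inClass r (z p) (z q)) p₀ ⟩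
        inClass 0 (z p) (z q)          ≡⟨ inClass₀-nonStar ¬star ⟩
        true                           ∎)
        where open ≡-Reasoning

      SameClassPair : (Fin (suc d) → Fin (2 * suc d)) → Set
      SameClassPair pos = ∃ λ t → ∃ λ t′ → pos t ≢ pos t′ × X (pos t) % d ≡ X (pos t′) % d

      sameClassPair : (pos : Fin (suc d) → Fin (2 * suc d)) → Injective _≡_ _≡_ pos → SameClassPair pos
      sameClassPair pos pos-injective with Finₚ.pigeonhole (n<1+n d) (λ t → X (pos t) mod d)
      ... | t , t′ , t<t′ , same = t , t′ , Finₚ.<⇒≢ t<t′ ∘ pos-injective ,
                                   trans (sym (toℕ-fromℕ< _)) (trans (cong toℕ same) (toℕ-fromℕ< _))

      even<2[1+d] : ∀ (t : Fin (suc d)) → 2 * toℕ t < 2 * suc d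
      even<2[1+d] t = *-monoʳ-< 2 (toℕ<n t)

      odd<2[1+d] : ∀ (t : Fin (suc d)) → suc (2 * toℕ t) < 2 * suc d
      odd<2[1+d] t = subst (_≤ 2 * suc d) (*-suc 2 (toℕ t)) (*-monoʳ-≤ 2 (toℕ<n t))

      even odd : Fin (suc d) → Fin (2 * suc d)
      even t = fromℕ< (even<2[1+d] t)
      odd  t = fromℕ< (odd<2[1+d] t)

      toℕ-even : ∀ t → toℕ (even t) ≡ 2 * toℕ t
      toℕ-even t = toℕ-fromℕ< (even<2[1+d] t)

      toℕ-odd : ∀ t → toℕ (odd t) ≡ suc (2 * toℕ t)
      toℕ-odd t = toℕ-fromℕ< (odd<2[1+d] t)

      even-injective : Injective _≡_ _≡_ even
      even-injective {t} {t′} eq = toℕ-injective (*-cancelˡ-≡ _ _ 2 (begin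
        2 * toℕ t     ≡⟨ toℕ-even t ⟨
        toℕ (even t)  ≡⟨ cong toℕ eq ⟩
        toℕ (even t′) ≡⟨ toℕ-even t′ ⟩
        2 * toℕ t′    ∎))
        where open ≡-Reasoning

      odd-injective : Injective _≡_ _≡_ odd
      odd-injective {t} {t′} eq = toℕ-injective (*-cancelˡ-≡ _ _ 2 (suc-injective (begin
        suc (2 * toℕ t)  ≡⟨ toℕ-odd t ⟨
        toℕ (odd t)      ≡⟨ cong toℕ eq ⟩
        toℕ (odd t′)     ≡⟨ toℕ-odd t′ ⟩
        suc (2 * toℕ t′) ∎)))
        where open ≡-Reasoning

      parity-even : ∀ t → parity (toℕ (even t)) ≡ 0ℙ
      parity-even t = trans (cong parity (toℕ-even t)) (*-homo-* 2 (toℕ t))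

      parity-odd : ∀ t → parity (toℕ (odd t)) ≡ 1ℙ
      parity-odd t =
        trans (cong parity (toℕ-odd t)) (trans (parity-suc (2 * toℕ t)) (cong _⁻¹ (*-homo-* 2 (toℕ t))))

      5≤2[1+d] : 5 ≤ 2 * suc d
      5≤2[1+d] = ≤-trans (n≤1+n 5) (*-monoʳ-≤ 2 (s≤s (s≤s 1≤d′)))

      -- Both pairs lie in class 0 and are joined in the star forest. A star edge between the pairs would
      -- give a path with three edges; otherwise i and j would have the common neighbours a and b on the cycle.
      twoSameClassPairs : ∀ {i j a b} → i ≢ j → a ≢ b → X i % d ≡ X j % d → X a % d ≡ X b % d →
                          parity (toℕ i) ≡ parity (toℕ j) → parity (toℕ a) ≡ parity (toℕ b) →
                          parity (toℕ i) ≢ parity (toℕ a) → ⊥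
      twoSameClassPairs {i} {j} {a} {b} i≢j a≢b ij ab πij πab πia =
        cases (star? (z i) (z a)) (star? (z i) (z b)) (star? (z j) (z a)) (star? (z j) (z b))
        where
        i₀ = proj₁ (sameClass⇒star i≢j ij πij)
        a₀ = proj₁ (sameClass⇒star a≢b ab πab)
        i~j = proj₂ (sameClass⇒star i≢j ij πij)
        a~b = proj₂ (sameClass⇒star a≢b ab πab)
        j₀ = trans (sym ij) i₀
        b₀ = trans (sym ab) a₀
        i≢a : i ≢ a
        i≢a = πia ∘ cong (parity ∘ toℕ)
        i≢b : i ≢ b
        i≢b i≡b = πia (trans (cong (parity ∘ toℕ) i≡b) (sym πab))
        j≢a : j ≢ a
        j≢a j≡a = πia (trans πij (cong (parity ∘ toℕ) j≡a))
        j≢b : j ≢ b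
        j≢b j≡b = πia (trans πij (trans (cong (parity ∘ toℕ) j≡b) (sym πab)))
        z≢ = class₀-index-injective
        cases : Dec (Star (z i) (z a)) → Dec (Star (z i) (z b)) →
                Dec (Star (z j) (z a)) → Dec (Star (z j) (z b)) → ⊥
        cases (yes i~a) _ _ _ = star-noPath₃ c-idem (star-sym i~j) i~a a~b (z≢ j≢a j₀ a₀) (z≢ i≢b i₀ b₀)
        cases _ (yes i~b) _ _ = star-noPath₃ c-idem (star-sym i~j) i~b (star-sym a~b) (z≢ j≢b j₀ b₀) (z≢ i≢a i₀ a₀)
        cases _ _ (yes j~a) _ = star-noPath₃ c-idem i~j j~a a~b (z≢ i≢a i₀ a₀) (z≢ j≢b j₀ b₀)
        cases _ _ _ (yes j~b) = star-noPath₃ c-idem i~j j~b (star-sym a~b) (z≢ i≢b i₀ b₀) (z≢ j≢a j₀ a₀)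
        cases (no ¬i~a) (no ¬i~b) (no ¬j~a) (no ¬j~b) =
          cycAdj-noCommonNeighbours 5≤2[1+d] i≢j a≢b
            (nonStar⇒cycAdj i≢a i₀ a₀ ¬i~a) (nonStar⇒cycAdj i≢b i₀ b₀ ¬i~b)
            (nonStar⇒cycAdj j≢a j₀ a₀ ¬j~a) (nonStar⇒cycAdj j≢b j₀ b₀ ¬j~b)

      noInducedCycle : ⊥
      noInducedCycle = pairs (sameClassPair even even-injective) (sameClassPair odd odd-injective)
        where
        pairs : SameClassPair even → SameClassPair odd → ⊥
        pairs (t , t′ , i≢j , ij) (s , s′ , a≢b , ab) = twoSameClassPairs i≢j a≢b ij ab
          (trans (parity-even t) (sym (parity-even t′)))
          (trans (parity-odd s) (sym (parity-odd s′)))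
          (λ πia → 0ℙ≢1ℙ (trans (sym (parity-even t)) (trans πia (parity-odd s))))
          where
          0ℙ≢1ℙ : 0ℙ ≢ 1ℙ
          0ℙ≢1ℙ ()

    graph-simple : (∀ x y → cross x y ≡ cross y x) → ∀ {n} → IsSimpleGraph (graph n)
    graph-simple cross-sym = adjMatrix-simple (adj-sym cross-sym) adj-irrefl

    graph-noInducedCycle : (∀ a → c (c a) ≡ c a) → 1 ≤ d′ → ∀ {n} → ¬ HasInducedCycle (graph n) (2 * suc d)
    graph-noInducedCycle c-idem 1≤d′ (v , v-injective , v-adj) =
      InducedCycle.noInducedCycle c-idem 1≤d′ v v-injective v-adj

    adj-class₀ : ∀ {w w′} → w ≢ w′ → adj (w * d) (w′ * d) ≡ not (does (star? w w′))
    adj-class₀ {w} {w′} w≢w′ = begin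
      adj (w * d) (w′ * d)
        ≡⟨ adj-inClass (w≢w′ ∘ *-cancelʳ-≡ w w′ d) (trans (m*n%n≡0 w d) (sym (m*n%n≡0 w′ d))) ⟩
      inClass ((w * d) % d) ((w * d) / d) ((w′ * d) / d)
        ≡⟨ cong₂ (inClass ((w * d) % d)) (m*n/n≡m w d) (m*n/n≡m w′ d) ⟩
      inClass ((w * d) % d) w w′
        ≡⟨ cong (λ r → inClass r w w′) (m*n%n≡0 w d) ⟩
      not (does (star? w w′))
        ∎
      where open ≡-Reasoning

  sameClass? : ∀ x y → Dec (y % d ≡ x % d)
  sameClass? x y = y % d ≟ x % d

  sameBelow crossBelow : ℕ → List ℕ
  sameBelow  x = filter (sameClass? x) (upTo x)
  crossBelow x = filter (∁? (sameClass? x)) (upTo x)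

  -- The pairs of vertices whose edge is chosen freely.
  crossPairs : ℕ → List (ℕ × ℕ)
  crossPairs n = concatMap (λ x → map (x ,_) (crossBelow x)) (upTo n)

  sameClass-/-< : ∀ {x y} → y < x → y % d ≡ x % d → y / d < x / d
  sameClass-/-< {x} {y} y<x same = ≰⇒> λ x/d≤y/d → <⇒≱ y<x (begin
    x                  ≡⟨ m≡m%n+[m/n]*n x d ⟩
    x % d + x / d * d  ≤⟨ +-monoʳ-≤ (x % d) (*-monoˡ-≤ d x/d≤y/d) ⟩
    x % d + y / d * d  ≡⟨ cong (_+ y / d * d) same ⟨
    y % d + y / d * d  ≡⟨ m≡m%n+[m/n]*n y d ⟨
    y                  ∎)
    where open ≤-Reasoning

  -- The vertices below x in the class of x are x % d + t * d for t < x / d.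
  length-sameBelow : ∀ x → length (sameBelow x) ≤ x / d
  length-sameBelow x = ≤-trans (Unique⇒length≤ (Unique.filter⁺ (sameClass? x) (upTo⁺ x)) sameBelow⊆)
                               (≤-reflexive (trans (length-map _ (upTo (x / d))) (length-upTo (x / d))))
    where
    sameBelow⊆ : sameBelow x ⊆ map (λ t → x % d + t * d) (upTo (x / d))
    sameBelow⊆ {y} y∈ with ∈-filter⁻ (sameClass? x) {xs = upTo x} y∈
    ... | y∈upTo , same = subst (_∈ _) (sym (trans (m≡m%n+[m/n]*n y d) (cong (_+ y / d * d) same)))
                                (∈-map⁺ _ (∈-upTo⁺ (sameClass-/-< (∈-upTo⁻ y∈upTo) same)))

  length-crossBelow : ∀ x → d′ * x ≤ d * length (crossBelow x)
  length-crossBelow x = +-cancelˡ-≤ x _ _ (begin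
    d * x                ≡⟨ cong (d *_) s+f≡x ⟨
    d * (s + f)          ≡⟨ *-distribˡ-+ d s f ⟩
    d * s + d * f        ≤⟨ +-monoˡ-≤ (d * f) (*-monoʳ-≤ d (length-sameBelow x)) ⟩
    d * (x / d) + d * f  ≡⟨ cong (_+ d * f) (*-comm d (x / d)) ⟩
    x / d * d + d * f    ≤⟨ +-monoˡ-≤ (d * f) (m/n*n≤m x d) ⟩
    x + d * f            ∎)
    where
    open ≤-Reasoning
    s = length (sameBelow x)
    f = length (crossBelow x)
    s+f≡x : s + f ≡ x
    s+f≡x = trans (length-filter+∁ (sameClass? x) (upTo x)) (length-upTo x)

  length-crossPairs : ∀ n → d′ * (n C 2) ≤ d * length (crossPairs n)
  length-crossPairs n = begin
    d′ * (n C 2)                                  ≡⟨ cong (d′ *_) (trans (cong sum (map-id (upTo n))) (sum-upTo n)) ⟨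
    d′ * sum (map (λ x → x) (upTo n))             ≤⟨ *-sum-mono-≤ d′ d _ _ (upTo n) length-crossBelow ⟩
    d * sum (map (length ∘ crossBelow) (upTo n))  ≡⟨ cong (d *_) length-crossPairs≡ ⟨
    d * length (crossPairs n)                     ∎
    where
    open ≤-Reasoning
    length-crossPairs≡ : length (crossPairs n) ≡ sum (map (length ∘ crossBelow) (upTo n))
    length-crossPairs≡ = trans (length-concatMap _ (upTo n))
                               (cong sum (map-cong (λ x → length-map (x ,_) (crossBelow x)) (upTo n)))

  ∈-crossPairs⁻ : ∀ {n x y} → (x , y) ∈ crossPairs n → y < x × x < n × x % d ≢ y % d
  ∈-crossPairs⁻ {n} xy∈ with find (∈-concatMap⁻ (λ x → map (x ,_) (crossBelow x)) {xs = upTo n} xy∈)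
  ... | x , x∈ , xy∈map with ∈-map⁻ (x ,_) xy∈map
  ... | y , y∈ , refl with ∈-filter⁻ (∁? (sameClass? x)) y∈
  ... | y∈upTo , diff = ∈-upTo⁻ y∈upTo , ∈-upTo⁻ x∈ , diff ∘ sym

  crossPairs-unique : ∀ n → Unique (crossPairs n)
  crossPairs-unique n = Unique.concat⁺ (All.map⁺ (All.universal unique (upTo n)))
                                      (AllPairs.map⁺ (AllPairs.map disjoint (upTo⁺ n)))
    where
    unique : ∀ x → Unique (map (x ,_) (crossBelow x))
    unique x = Unique.map⁺ (cong proj₂) (Unique.filter⁺ (∁? (sameClass? x)) (upTo⁺ x))
    disjoint : ∀ {x x′} → x ≢ x′ → Disjoint (map (x ,_) (crossBelow x)) (map (x′ ,_) (crossBelow x′))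
    disjoint {x} {x′} x≢x′ (v∈ , v∈′) with ∈-map⁻ (x ,_) v∈ | ∈-map⁻ (x′ ,_) v∈′
    ... | _ , _ , refl | _ , _ , eq = x≢x′ (cong proj₁ eq)

  index<⌈n/d⌉ : ∀ {n w} → w < ceilDiv n d → w * d < n
  index<⌈n/d⌉ {n} {w} w<m = +-cancelʳ-≤ d′ (suc (w * d)) n (begin
    suc (w * d) + d′         ≡⟨ cong suc (+-comm (w * d) d′) ⟩
    suc w * d                ≤⟨ *-monoˡ-≤ d w<m ⟩
    (n + d′) / d * d         ≤⟨ m/n*n≤m (n + d′) d ⟩
    n + d′                   ∎)
    where open ≤-Reasoning

  module Family (n : ℕ) where

    m K : ℕ
    m = ceilDiv n d
    K = length (crossPairs n)

    _≟ₚ_ : DecidableEquality (ℕ × ℕ)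
    _≟ₚ_ = ×-≡-dec _≟_ _≟_

    crossBits : Vec Bool K → ℕ → ℕ → Bool
    crossBits bs x y = bitAt _≟ₚ_ (crossPairs n) bs (x ⊔ y , x ⊓ y)

    crossBits-sym : ∀ bs x y → crossBits bs x y ≡ crossBits bs y x
    crossBits-sym bs x y = cong₂ (λ a b → bitAt _≟ₚ_ (crossPairs n) bs (a , b)) (⊔-comm x y) (⊓-comm x y)

    goodGraph : Partition (upTo m) → Vec Bool K → AdjMatrix n
    goodGraph p bs = Adjacency.graph (rep p) (crossBits bs) n

    -- In class 0 the vertices w and rep p w are non-adjacent for p but adjacent for p′; rep p′ (rep p w)
    -- cannot be w because representatives are minima.
    goodGraph-separates : ∀ {p p′ bs bs′ w} → rep p w ≢ w → rep p′ w ≢ rep p w →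
                          goodGraph p bs ≢ goodGraph p′ bs′
    goodGraph-separates {p} {p′} {bs} {bs′} {w} pw≢w p′w≢pw eq = contradiction (begin
      false                               ≡⟨ cong not (dec-true (G.star? w (rep p w)) star) ⟨
      not (does (G.star? w (rep p w)))    ≡⟨ G.adj-class₀ (pw≢w ∘ sym) ⟨
      G.adj (w * d) (rep p w * d)         ≡⟨ adjMatrix-injective {f = G.adj} {g = G′.adj} eq w*d<n pw*d<n ⟩
      G′.adj (w * d) (rep p w * d)        ≡⟨ G′.adj-class₀ (pw≢w ∘ sym) ⟩
      not (does (G′.star? w (rep p w)))   ≡⟨ cong not (dec-false (G′.star? w (rep p w)) ¬star′) ⟩
      true                                ∎) (λ ())
      where
      open ≡-Reasoning
      module G  = Adjacency (rep p) (crossBits bs)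
      module G′ = Adjacency (rep p′) (crossBits bs′)
      w*d<n : w * d < n
      w*d<n = index<⌈n/d⌉ (∈-upTo⁻ (rep≢⇒∈ p pw≢w))
      pw*d<n : rep p w * d < n
      pw*d<n = ≤-<-trans (*-monoˡ-≤ d (rep-≤ p w)) w*d<n
      star : G.Star w (rep p w)
      star = pw≢w ∘ sym , inj₁ refl
      ¬star′ : ¬ G′.Star w (rep p w)
      ¬star′ (_ , inj₁ p′w≡pw) = p′w≢pw p′w≡pw
      ¬star′ (_ , inj₂ p′pw≡w) =
        <⇒≱ (≤∧≢⇒< (rep-≤ p w) pw≢w) (subst (_≤ rep p w) p′pw≡w (rep-≤ p′ (rep p w)))

    goodGraph-injective : ∀ {p p′ bs bs′} → goodGraph p bs ≡ goodGraph p′ bs′ → p ≈ᴾ p′ × bs ≡ bs′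
    goodGraph-injective {p} {p′} {bs} {bs′} eq = sameRep , bitAt-injective _≟ₚ_ (crossPairs-unique n) sameBit
      where
      module G  = Adjacency (rep p) (crossBits bs)
      module G′ = Adjacency (rep p′) (crossBits bs′)
      sameRep : ∀ w → rep p w ≡ rep p′ w
      sameRep w with rep p w ≟ rep p′ w | rep p w ≟ w
      ... | yes same | _        = same
      ... | no  diff | no  pw≢w = contradiction eq (goodGraph-separates {p} {p′} {bs} {bs′} pw≢w (diff ∘ sym))
      ... | no  diff | yes pw≡w =
        contradiction (sym eq) (goodGraph-separates {p′} {p} {bs′} {bs} (diff ∘ trans pw≡w ∘ sym) diff)
      sameBit : ∀ {k} → k ∈ crossPairs n → bitAt _≟ₚ_ (crossPairs n) bs k ≡ bitAt _≟ₚ_ (crossPairs n) bs′ k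
      sameBit {x , y} k∈ with ∈-crossPairs⁻ k∈
      ... | y<x , x<n , diff = begin
        bitAt _≟ₚ_ (crossPairs n) bs (x , y)   ≡⟨ cong (bitAt _≟ₚ_ (crossPairs n) bs) ordered ⟨
        crossBits bs x y                       ≡⟨ G.adj-cross diff ⟨
        G.adj x y                              ≡⟨ adjMatrix-injective {f = G.adj} {g = G′.adj} eq x<n (<-trans y<x x<n) ⟩
        G′.adj x y                             ≡⟨ G′.adj-cross diff ⟩
        crossBits bs′ x y                      ≡⟨ cong (bitAt _≟ₚ_ (crossPairs n) bs′) ordered ⟩
        bitAt _≟ₚ_ (crossPairs n) bs′ (x , y)  ∎
        where
        open ≡-Reasoning
        ordered : (x ⊔ y , x ⊓ y) ≡ (x , y)
        ordered = cong₂ _,_ (m≥n⇒m⊔n≡m (<⇒≤ y<x)) (m≥n⇒m⊓n≡n (<⇒≤ y<x))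

    blockPartitions : List (Partition (upTo m))
    blockPartitions = partitions m (upTo m) (upTo-increasing m)

    bitVectors : List (Vec Bool K)
    bitVectors = allVecs (true ∷ false ∷ []) K

    goodGraphs : List (AdjMatrix n)
    goodGraphs = cartesianProductWith goodGraph blockPartitions bitVectors

    length-goodGraphs : length goodGraphs ≡ Bell m * 2 ^ K
    length-goodGraphs = begin
      length goodGraphs                           ≡⟨ length-cartesianProductWith goodGraph blockPartitions bitVectors ⟩
      length blockPartitions * length bitVectors  ≡⟨ cong (_* length bitVectors) length-blockPartitions ⟩
      Bell (length (upTo m)) * length bitVectors  ≡⟨ cong₂ _*_ (cong Bell (length-upTo m)) (length-allVecs _ K) ⟩
      Bell m * 2 ^ K                              ∎
      where
      open ≡-Reasoning
      length-blockPartitions = length-partitions m (upTo m) (upTo-increasing m) (≤-reflexive (length-upTo m))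

    goodGraphs-unique : Unique goodGraphs
    goodGraphs-unique =
      SetoidUniqueₚ.cartesianProductWith⁺ (partitionSetoid (upTo m)) (setoid (Vec Bool K)) (setoid (AdjMatrix n))
        goodGraph (λ {p} {p′} {bs} {bs′} → goodGraph-injective {p} {p′} {bs} {bs′})
        (partitions-unique m (upTo m) (upTo-increasing m)) (allVecs-unique (((λ ()) ∷ []) ∷ [] ∷ []) K)

    goodGraphs-count : 1 ≤ d′ → (L : List (AdjMatrix n)) →
                       ((M : AdjMatrix n) → (M ∈ L) ⇔ (IsSimpleGraph M × ¬ HasInducedCycle M (2 * suc d))) →
                       Bell m * 2 ^ K ≤ length L
    goodGraphs-count 1≤d′ L L-spec =
      ≤-trans (≤-reflexive (sym length-goodGraphs)) (Unique⇒length≤ goodGraphs-unique goodGraphs⊆L)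
      where
      goodGraphs⊆L : goodGraphs ⊆ L
      goodGraphs⊆L M∈ with ∈-cartesianProductWith⁻ goodGraph blockPartitions bitVectors M∈
      ... | p , bs , _ , _ , refl = Equivalence.from (L-spec _)
        ( Adjacency.graph-simple (rep p) (crossBits bs) (crossBits-sym bs)
        , Adjacency.graph-noInducedCycle (rep p) (crossBits bs) (rep-idem p) 1≤d′)

^-distribʳ-* : ∀ a b k → (a * b) ^ k ≡ a ^ k * b ^ k
^-distribʳ-* a b zero    = refl
^-distribʳ-* a b (suc k) = trans (cong (a * b *_) (^-distribʳ-* a b k)) (*-interchange a b (a ^ k) (b ^ k))

power-bound : ∀ d e B K L → e ≤ d * K → B * 2 ^ K ≤ L → 2 ^ e * B ^ d ≤ L ^ d
power-bound d e B K L e≤dK B2ᴷ≤L = begin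
  2 ^ e * B ^ d          ≤⟨ *-monoˡ-≤ (B ^ d) (^-monoʳ-≤ 2 e≤dK) ⟩
  2 ^ (d * K) * B ^ d    ≡⟨ cong (λ t → 2 ^ t * B ^ d) (*-comm d K) ⟩
  2 ^ (K * d) * B ^ d    ≡⟨ cong (_* B ^ d) (^-*-assoc 2 K d) ⟨
  (2 ^ K) ^ d * B ^ d    ≡⟨ *-comm ((2 ^ K) ^ d) (B ^ d) ⟩
  B ^ d * (2 ^ K) ^ d    ≡⟨ ^-distribʳ-* B (2 ^ K) d ⟨
  (B * 2 ^ K) ^ d        ≤⟨ ^-monoˡ-≤ d B2ᴷ≤L ⟩
  L ^ d                  ∎
  where open ≤-Reasoning

-- Only the inclusion of the good graphs in L is needed, not that L is duplicate-free.
mainTheorem12 : (l n : ℕ) → 3 < l → (L : List (AdjMatrix n)) → Unique L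
    → ((M : AdjMatrix n) → (M ∈ L) ⇔ (IsSimpleGraph M × ¬ HasInducedCycle M (2 * l)))
    → 2 ^ ((l ∸ 2) * (n C 2)) * Bell (ceilDiv n (l ∸ 1)) ^ (l ∸ 1) ≤ length L ^ (l ∸ 1)
mainTheorem12 (suc (suc (suc (suc e)))) n (s≤s (s≤s (s≤s (s≤s _)))) L _ L-spec =
  power-bound d (suc (suc e) * (n C 2)) (Bell m) K (length L)
    (length-crossPairs n) (goodGraphs-count (s≤s z≤n) L L-spec)
  where
  open Construction (suc (suc e))
  open Family n
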